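{- Let $n,k,t,s$ be positive integers with $k\geq t+1$ and $n\geq 2k$. Suppose that $\mathcal{F},\mathcal{G}\subseteq\binom{[n]}{k}$ are non-empty maximal $s$-almost cross-$t$-intersecting families. If $\tau_t(\mathcal{F})\leq k$ and $\tau_t(\mathcal{G})\leq k$, then $\mathcal{T}_t(\mathcal{F})$ and $\mathcal{T}_t(\mathcal{G})$ are cross-$t$-intersecting, i.e., $|T\cap T'|\geq t$ for all $T\in\mathcal{T}_t(\mathcal{F})$ and $T'\in\mathcal{T}_t(\mathcal{G})$.
   Context: $[n]=\{1,\dots,n\}$, $\binom{X}{k}$ is the family of $k$-subsets of $X$. Two sets are $t$-disjoint if they share fewer than $t$ elements. Families $\mathcal{F},\mathcal{G}$ are $s$-almost cross-$t$-intersecting if each member of $\mathcal{F}$ is $t$-disjoint with at most $s$ members of $\mathcal{G}$ and vice versa. They are maximal if for any $s$-almost cross-$t$-intersecting $\mathcal{F}',\mathcal{G}'\subseteq\binom{[n]}{k}$ with $\mathcal{F}\subseteq\mathcal{F}'$ and $\mathcal{G}\subseteq\mathcal{G}'$ one has $\mathcal{F}'=\mathcal{F}$ and $\mathcal{G}'=\mathcal{G}$. A $t$-cover of a family $\mathcal{F}$ is a set $T\subseteq[n]$ with $|T\cap F|\geq t$ for all $F\in\mathcal{F}$; $\tau_t(\mathcal{F})$ is the minimum size of a $t$-cover, and $\mathcal{T}_t(\mathcal{F})$ is the family of all $t$-covers of $\mathcal{F}$ of size $\tau_t(\mathcal{F})$. The paper assumes throughout that $s$-almost cross-$t$-intersecting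 families are non-empty. -}

module Defs where

open import Data.Nat using (ℕ; zero; suc; _≤_; _<_)
open import Data.Bool using (Bool; true; false; if_then_else_)
open import Data.Vec using (_∷_; [])
open import Data.List using (List; []; _∷_; map; _++_; length; filter)
open import Data.Fin.Subset using (Subset; _∩_; ∣_∣)
open import Data.Product using (Σ; _×_; ∃)
open import Relation.Binary.PropositionalEquality using (_≡_)
open import Relation.Nullary using (¬_)
open import Data.Nat using (_<?_)

Family : ℕ → Set
Family n = Subset n → Bool

_∈F_ : ∀ {n} → Subset n → Family n → Set
A ∈F 𝓕 = 𝓕 A ≡ true

_⊆F_ : ∀ {n} → Family n → Family n → Set
𝓕 ⊆F 𝓖 = ∀ A → A ∈F 𝓕 → A ∈F 𝓖

_≐F_ : ∀ {n} → Family n → Family n → Set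
𝓕 ≐F 𝓖 = ∀ A → 𝓕 A ≡ 𝓖 A

Uniform : ∀ {n} → ℕ → Family n → Set
Uniform k 𝓕 = ∀ A → A ∈F 𝓕 → ∣ A ∣ ≡ k

NonEmptyF : ∀ {n} → Family n → Set
NonEmptyF 𝓕 = ∃ λ A → A ∈F 𝓕

allSubsets : (n : ℕ) → List (Subset n)
allSubsets zero = [] ∷ []
allSubsets (suc n) = map (false ∷_) (allSubsets n) ++ map (true ∷_) (allSubsets n)

tDisjoint : ∀ {n} → ℕ → Subset n → Subset n → Set
tDisjoint t A B = ∣ A ∩ B ∣ < t

countDisjoint : ∀ {n} → ℕ → Subset n → Family n → ℕ
countDisjoint {n} t A 𝓖 =
  length (filter (λ B → ∣ A ∩ B ∣ <? t) (filter (λ B → 𝓖 B Data.Bool.≟ true) (allSubsets n)))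

AlmostCrossInt : ∀ {n} → ℕ → ℕ → Family n → Family n → Set
AlmostCrossInt s t 𝓕 𝓖 =
  (∀ A → A ∈F 𝓕 → countDisjoint t A 𝓖 ≤ s) ×
  (∀ B → B ∈F 𝓖 → countDisjoint t B 𝓕 ≤ s)

MaximalACI : ∀ {n} → ℕ → ℕ → ℕ → Family n → Family n → Set
MaximalACI {n} k s t 𝓕 𝓖 =
  Uniform k 𝓕 × Uniform k 𝓖 × AlmostCrossInt s t 𝓕 𝓖 ×
  (∀ (𝓕′ 𝓖′ : Family n) → Uniform k 𝓕′ → Uniform k 𝓖′ →
     AlmostCrossInt s t 𝓕′ 𝓖′ → 𝓕 ⊆F 𝓕′ → 𝓖 ⊆F 𝓖′ →
     (𝓕′ ≐F 𝓕) × (𝓖′ ≐F 𝓖))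

IsTCover : ∀ {n} → ℕ → Family n → Subset n → Set
IsTCover t 𝓕 T = ∀ A → A ∈F 𝓕 → t Data.Nat.≤ ∣ A ∩ T ∣

TauLe : ∀ {n} → ℕ → Family n → ℕ → Set
TauLe t 𝓕 m = ∃ λ T → IsTCover t 𝓕 T × ∣ T ∣ ≤ m

MinTCover : ∀ {n} → ℕ → Family n → Subset n → Set
MinTCover t 𝓕 T = IsTCover t 𝓕 T × (∀ T′ → IsTCover t 𝓕 T′ → ∣ T ∣ ≤ ∣ T′ ∣)

{-# OPTIONS --safe #-}
-- Extend a minimum t-cover T of 𝓕 (so |T| ≤ k) to a k-set A ⊇ T by adding points
-- outside T ∪ T′; there is room because n ≥ 2k, and A ∩ T′ = T ∩ T′. As A ⊇ T,
-- A t-intersects every member of 𝓕, so adding A to 𝓖 creates no new t-disjoint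
-- pairs, and maximality forces A ∈ 𝓖. Since T′ is a t-cover of 𝓖,
-- t ≤ |A ∩ T′| = |T ∩ T′|.
module Submission where

open import Defs
open import Data.Nat using (ℕ; _≤_; _*_; _+_; zero; suc; _∸_; z≤n; s≤s; s≤s⁻¹; _<?_)
open import Data.Fin.Subset using (Subset; _∩_; ∣_∣; _⊆_; _∪_; ∁; inside; outside)
open import Data.Nat.Properties
open import Data.Bool using (true; _∨_)
import Data.Bool as Bool
open import Data.Vec using (_∷_; [])
open import Data.Vec.Properties using (≡-dec)
open import Data.Fin.Subset.Properties
  using (∣p∣≤∣x∷p∣; ∣∁p∣≡n∸∣p∣; p⊆q⇒∣p∣≤∣q∣; s⊆s; out⊆; x∈p∩q⁺; x∈p∩q⁻; ∩-comm)
open import Data.List using ([]; _∷_; filter; length)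
open import Data.List.Properties using (filter-none)
open import Data.List.Relation.Unary.All as All using ()
open import Data.List.Relation.Unary.All.Properties using (all-filter)
open import Data.Product using (_×_; _,_; proj₁; proj₂)
open import Data.Sum using (_⊎_; inj₁; inj₂)
open import Level using (Level)
open import Relation.Binary.PropositionalEquality
open import Relation.Nullary using (¬_; yes; no; does; contradiction)
open import Relation.Unary using (Pred; Decidable)

private
  variable
    a p : Level
    n k s t : ℕ

∣p∪q∣≤∣p∣+∣q∣ : ∀ (x y : Subset n) → ∣ x ∪ y ∣ ≤ ∣ x ∣ + ∣ y ∣
∣p∪q∣≤∣p∣+∣q∣ []            []           = z≤n
∣p∪q∣≤∣p∣+∣q∣ (inside ∷ x)  (b ∷ y)      =
  s≤s (≤-trans (∣p∪q∣≤∣p∣+∣q∣ x y) (+-monoʳ-≤ ∣ x ∣ (∣p∣≤∣x∷p∣ b y)))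
∣p∪q∣≤∣p∣+∣q∣ (outside ∷ x) (inside ∷ y) =
  ≤-trans (s≤s (∣p∪q∣≤∣p∣+∣q∣ x y)) (≤-reflexive (sym (+-suc ∣ x ∣ ∣ y ∣)))
∣p∪q∣≤∣p∣+∣q∣ (outside ∷ x) (outside ∷ y) = ∣p∪q∣≤∣p∣+∣q∣ x y

∩-monoʳ-⊆ : ∀ (z : Subset n) {x y} → x ⊆ y → z ∩ x ⊆ z ∩ y
∩-monoʳ-⊆ z {x} x⊆y i∈z∩x with x∈p∩q⁻ z x i∈z∩x
... | i∈z , i∈x = x∈p∩q⁺ (i∈z , x⊆y i∈x)

pad : ℕ → Subset n → Subset n → Subset n
pad m       []            []            = []
pad m       (inside ∷ x)  (_ ∷ y)       = inside ∷ pad m x y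
pad m       (outside ∷ x) (inside ∷ y)  = outside ∷ pad m x y
pad zero    (outside ∷ x) (outside ∷ y) = outside ∷ pad zero x y
pad (suc m) (outside ∷ x) (outside ∷ y) = inside ∷ pad m x y

⊆-pad : ∀ m (x y : Subset n) → x ⊆ pad m x y
⊆-pad m       []            []            = λ ()
⊆-pad m       (inside ∷ x)  (_ ∷ y)       = s⊆s (⊆-pad m x y)
⊆-pad m       (outside ∷ x) (inside ∷ y)  = out⊆ (⊆-pad m x y)
⊆-pad zero    (outside ∷ x) (outside ∷ y) = out⊆ (⊆-pad zero x y)
⊆-pad (suc m) (outside ∷ x) (outside ∷ y) = out⊆ (⊆-pad m x y)

pad-∩ : ∀ m (x y : Subset n) → pad m x y ∩ y ≡ x ∩ y
pad-∩ m       []            []            = refl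
pad-∩ m       (inside ∷ x)  (b ∷ y)       = cong (b ∷_) (pad-∩ m x y)
pad-∩ m       (outside ∷ x) (inside ∷ y)  = cong (outside ∷_) (pad-∩ m x y)
pad-∩ zero    (outside ∷ x) (outside ∷ y) = cong (outside ∷_) (pad-∩ zero x y)
pad-∩ (suc m) (outside ∷ x) (outside ∷ y) = cong (outside ∷_) (pad-∩ m x y)

∣pad∣ : ∀ m (x y : Subset n) → m ≤ ∣ ∁ (x ∪ y) ∣ → ∣ pad m x y ∣ ≡ ∣ x ∣ + m
∣pad∣ zero    []            []            _ = refl
∣pad∣ (suc m) []            []            ()
∣pad∣ m       (inside ∷ x)  (_ ∷ y)       h = cong suc (∣pad∣ m x y h)
∣pad∣ m       (outside ∷ x) (inside ∷ y)  h = ∣pad∣ m x y h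
∣pad∣ zero    (outside ∷ x) (outside ∷ y) _ = ∣pad∣ zero x y z≤n
∣pad∣ (suc m) (outside ∷ x) (outside ∷ y) h =
  trans (cong suc (∣pad∣ m x y (s≤s⁻¹ h))) (sym (+-suc ∣ x ∣ m))

room-outside-∪ : ∀ (x y : Subset n) → ∣ x ∣ ≤ k → ∣ y ∣ ≤ k → 2 * k ≤ n →
                 k ∸ ∣ x ∣ ≤ ∣ ∁ (x ∪ y) ∣
room-outside-∪ {n} {k} x y ∣x∣≤k ∣y∣≤k 2k≤n = begin
  k ∸ ∣ x ∣               ≡⟨ sym ([m+n]∸[m+o]≡n∸o k k ∣ x ∣) ⟩
  (k + k) ∸ (k + ∣ x ∣)   ≤⟨ ∸-mono k+k≤n ∣x∪y∣≤k+∣x∣ ⟩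
  n ∸ ∣ x ∪ y ∣           ≡⟨ sym (∣∁p∣≡n∸∣p∣ (x ∪ y)) ⟩
  ∣ ∁ (x ∪ y) ∣           ∎
  where
  open ≤-Reasoning
  k+k≤n : k + k ≤ n
  k+k≤n = subst (_≤ n) (cong (k +_) (+-identityʳ k)) 2k≤n
  ∣x∪y∣≤k+∣x∣ : ∣ x ∪ y ∣ ≤ k + ∣ x ∣
  ∣x∪y∣≤k+∣x∣ = ≤-trans (∣p∪q∣≤∣p∣+∣q∣ x y)
                  (≤-trans (+-monoʳ-≤ ∣ x ∣ ∣y∣≤k) (≤-reflexive (+-comm ∣ x ∣ k)))

length-filter-filter-mono : {X : Set a} {P Q Q′ : Pred X p}
  (P? : Decidable P) (Q? : Decidable Q) (Q′? : Decidable Q′) →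
  (∀ {x} → Q x → P x → Q′ x) →
  ∀ xs → length (filter P? (filter Q? xs)) ≤ length (filter P? (filter Q′? xs))
length-filter-filter-mono P? Q? Q′? Q∧P⇒Q′ []       = z≤n
length-filter-filter-mono P? Q? Q′? Q∧P⇒Q′ (x ∷ xs) with Q? x | Q′? x
... | yes _  | yes _   with P? x
...   | yes _  = s≤s (length-filter-filter-mono P? Q? Q′? Q∧P⇒Q′ xs)
...   | no _   = length-filter-filter-mono P? Q? Q′? Q∧P⇒Q′ xs
length-filter-filter-mono P? Q? Q′? Q∧P⇒Q′ (x ∷ xs) | yes qx | no ¬q′x with P? x
...   | yes px = contradiction (Q∧P⇒Q′ qx px) ¬q′x
...   | no _   = length-filter-filter-mono P? Q? Q′? Q∧P⇒Q′ xs
length-filter-filter-mono P? Q? Q′? Q∧P⇒Q′ (x ∷ xs) | no _   | yes _   with P? x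
...   | yes _  = m≤n⇒m≤1+n (length-filter-filter-mono P? Q? Q′? Q∧P⇒Q′ xs)
...   | no _   = length-filter-filter-mono P? Q? Q′? Q∧P⇒Q′ xs
length-filter-filter-mono P? Q? Q′? Q∧P⇒Q′ (x ∷ xs) | no _   | no _ =
  length-filter-filter-mono P? Q? Q′? Q∧P⇒Q′ xs

countDisjoint-mono : ∀ (A : Subset n) {𝓖 𝓖′} →
  (∀ B → B ∈F 𝓖′ → tDisjoint t A B → B ∈F 𝓖) →
  countDisjoint t A 𝓖′ ≤ countDisjoint t A 𝓖
countDisjoint-mono {n} {t} A {𝓖} {𝓖′} h =
  length-filter-filter-mono (λ B → ∣ A ∩ B ∣ <? t)
    (λ B → 𝓖′ B Bool.≟ true) (λ B → 𝓖 B Bool.≟ true) (λ {B} → h B) (allSubsets n)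

countDisjoint-none : ∀ (A : Subset n) {𝓖} →
  (∀ B → B ∈F 𝓖 → ¬ tDisjoint t A B) → countDisjoint t A 𝓖 ≡ 0
countDisjoint-none {n} {t} A {𝓖} h =
  cong length (filter-none (λ B → ∣ A ∩ B ∣ <? t)
    (All.map (λ {B} → h B) (all-filter (λ B → 𝓖 B Bool.≟ true) (allSubsets n))))

insertF : Subset n → Family n → Family n
insertF A 𝓖 B = does (≡-dec Bool._≟_ B A) ∨ 𝓖 B

insertF-∈ : ∀ (A : Subset n) 𝓖 → A ∈F insertF A 𝓖
insertF-∈ A 𝓖 with ≡-dec Bool._≟_ A A
... | yes _    = refl
... | no A≢A   = contradiction refl A≢A

⊆F-insertF : ∀ (A : Subset n) 𝓖 → 𝓖 ⊆F insertF A 𝓖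
⊆F-insertF A 𝓖 B B∈𝓖 with ≡-dec Bool._≟_ B A
... | yes _ = refl
... | no _  = B∈𝓖

insertF-∈⁻ : ∀ (A : Subset n) 𝓖 B → B ∈F insertF A 𝓖 → B ≡ A ⊎ B ∈F 𝓖
insertF-∈⁻ A 𝓖 B B∈ with ≡-dec Bool._≟_ B A
... | yes B≡A = inj₁ B≡A
... | no _    = inj₂ B∈

IsTCover-⊆ : ∀ {𝓕 : Family n} {T A} → IsTCover t 𝓕 T → T ⊆ A → IsTCover t 𝓕 A
IsTCover-⊆ {T = T} {A} cover T⊆A F F∈𝓕 =
  ≤-trans (cover F F∈𝓕) (p⊆q⇒∣p∣≤∣q∣ (∩-monoʳ-⊆ F T⊆A))

MinTCover-≤ : ∀ {𝓕 : Family n} {T m} → MinTCover t 𝓕 T → TauLe t 𝓕 m → ∣ T ∣ ≤ m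
MinTCover-≤ (_ , minimal) (T₀ , cover₀ , ∣T₀∣≤m) = ≤-trans (minimal T₀ cover₀) ∣T₀∣≤m

AlmostCrossInt-insertʳ : ∀ {𝓕 𝓖 : Family n} {A} → AlmostCrossInt s t 𝓕 𝓖 →
  IsTCover t 𝓕 A → AlmostCrossInt s t 𝓕 (insertF A 𝓖)
AlmostCrossInt-insertʳ {s = s} {t} {𝓕} {𝓖} {A} (acF , acG) coverA = acF′ , acG′
  where
  acF′ : ∀ F → F ∈F 𝓕 → countDisjoint t F (insertF A 𝓖) ≤ s
  acF′ F F∈𝓕 = ≤-trans (countDisjoint-mono F new-not-disjoint) (acF F F∈𝓕)
    where
    new-not-disjoint : ∀ B → B ∈F insertF A 𝓖 → tDisjoint t F B → B ∈F 𝓖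
    new-not-disjoint B B∈ F∩B<t with insertF-∈⁻ A 𝓖 B B∈
    ... | inj₁ refl = contradiction (coverA F F∈𝓕) (<⇒≱ F∩B<t)
    ... | inj₂ B∈𝓖  = B∈𝓖
  acG′ : ∀ B → B ∈F insertF A 𝓖 → countDisjoint t B 𝓕 ≤ s
  acG′ B B∈ with insertF-∈⁻ A 𝓖 B B∈
  ... | inj₂ B∈𝓖  = acG B B∈𝓖
  ... | inj₁ refl = ≤-trans (≤-reflexive (countDisjoint-none A A-meets)) z≤n
    where
    A-meets : ∀ F → F ∈F 𝓕 → ¬ tDisjoint t A F
    A-meets F F∈𝓕 A∩F<t =
      <⇒≱ A∩F<t (subst (t ≤_) (cong ∣_∣ (∩-comm F A)) (coverA F F∈𝓕))

MaximalACI-cover-∈ : ∀ {𝓕 𝓖 : Family n} {A} → MaximalACI k s t 𝓕 𝓖 →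
  ∣ A ∣ ≡ k → IsTCover t 𝓕 A → A ∈F 𝓖
MaximalACI-cover-∈ {k = k} {𝓕 = 𝓕} {𝓖} {A} (uF , uG , ac , maximal) ∣A∣≡k coverA =
  trans (sym (proj₂ insertF-absorbed A)) (insertF-∈ A 𝓖)
  where
  uniform′ : Uniform k (insertF A 𝓖)
  uniform′ B B∈ with insertF-∈⁻ A 𝓖 B B∈
  ... | inj₁ refl = ∣A∣≡k
  ... | inj₂ B∈𝓖  = uG B B∈𝓖
  insertF-absorbed : (𝓕 ≐F 𝓕) × (insertF A 𝓖 ≐F 𝓖)
  insertF-absorbed = maximal 𝓕 (insertF A 𝓖) uF uniform′ (AlmostCrossInt-insertʳ ac coverA)
                   (λ _ F∈𝓕 → F∈𝓕) (⊆F-insertF A 𝓖)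

lemma2p5 : (n k t s : ℕ) → 1 ≤ n → 1 ≤ k → 1 ≤ t → 1 ≤ s →
    t + 1 ≤ k → 2 * k ≤ n →
    (𝓕 𝓖 : Family n) → NonEmptyF 𝓕 → NonEmptyF 𝓖 →
    MaximalACI k s t 𝓕 𝓖 →
    TauLe t 𝓕 k → TauLe t 𝓖 k →
    (T T′ : Subset n) → MinTCover t 𝓕 T → MinTCover t 𝓖 T′ →
    t ≤ ∣ T ∩ T′ ∣
lemma2p5 n k t s _ _ _ _ _ 2k≤n 𝓕 𝓖 _ _ maximal τ𝓕≤k τ𝓖≤k T T′ minT minT′ =
  subst (t ≤_) (cong ∣_∣ (pad-∩ m T T′)) (proj₁ minT′ A A∈𝓖)
  where
  ∣T∣≤k : ∣ T ∣ ≤ k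
  ∣T∣≤k = MinTCover-≤ minT τ𝓕≤k
  m : ℕ
  m = k ∸ ∣ T ∣
  A : Subset n
  A = pad m T T′
  ∣A∣≡k : ∣ A ∣ ≡ k
  ∣A∣≡k = trans (∣pad∣ m T T′ (room-outside-∪ T T′ ∣T∣≤k (MinTCover-≤ minT′ τ𝓖≤k) 2k≤n))
                (m+[n∸m]≡n ∣T∣≤k)
  A∈𝓖 : A ∈F 𝓖
  A∈𝓖 = MaximalACI-cover-∈ maximal ∣A∣≡k (IsTCover-⊆ (proj₁ minT) (⊆-pad m T T′))
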